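{- Let $<$ be a relation on a type $A$. If a list $l:\mathsf{List}\,A$ is $<^L$-accessible, then it is $<^{\circ}$-accessible.
   Context: Homotopy type theory setting; relations are arbitrary type families. $\mathsf{rot}:\mathsf{List}\,A\to\mathsf{List}\,A$ moves the first element (if any) to the end. The relation $<^L$ on $\mathsf{List}\,A$ is inductively generated by: if every element $y$ of $k$ satisfies $y<x$, then $(l_1::k::l_3)<^L(l_1::[x]::l_3)$. $(k<^{\circ}l):=\Sigma(n:\mathbb N).\,\mathsf{rot}^n(k)<^Ll$. $\mathsf{acc}^<$ is inductively generated by $\mathsf{step}:(\Pi x.(x<a)\to\mathsf{acc}^<(x))\to\mathsf{acc}^<(a)$. -}

module Defs where

open import Level using (Level; _⊔_)
open import Data.Nat using (ℕ; zero; suc)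
open import Data.List using (List; []; _∷_; _++_; [_])
open import Data.List.Relation.Unary.All using (All)
open import Data.Product using (Σ)
open import Function using (_∘_)

private
  variable
    a r : Level

rot : {A : Set a} → List A → List A
rot []       = []
rot (x ∷ xs) = xs ++ [ x ]

rot^ : {A : Set a} → ℕ → List A → List A
rot^ zero    l = l
rot^ (suc n) l = rot (rot^ n l)

data _<ᴸ_ {A : Set a} {_<_ : A → A → Set r} : List A → List A → Set (a ⊔ r) where
  ext : (l₁ k l₃ : List A) (x : A) → All (λ y → y < x) k →
        (l₁ ++ k ++ l₃) <ᴸ (l₁ ++ [ x ] ++ l₃)

ListRel : {A : Set a} → (A → A → Set r) → List A → List A → Set (a ⊔ r)
ListRel _<_ = _<ᴸ_ {_<_ = _<_}

RotRel : {A : Set a} → (A → A → Set r) → List A → List A → Set (a ⊔ r)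
RotRel _<_ k l = Σ ℕ (λ n → ListRel _<_ (rot^ n k) l)

data acc {A : Set a} (_<_ : A → A → Set r) : A → Set (a ⊔ r) where
  step : {z : A} → ((x : A) → x < z → acc _<_ x) → acc _<_ z

module Submission where

-- The key observation is that <° is invariant under rotating its RIGHT
-- argument: if k <ᴸ l then some rotation of k is <ᴸ-below rot l (the
-- replaced position either stays inside the list or wraps around to the
-- end), hence j <° m implies j <° rot m.  Consequently every <°-predecessor
-- of m is a <°-predecessor of rot m, so <°-accessibility of rot m entails
-- that of m, and by iteration that of any m from that of rotⁿ m.
--
-- The theorem then follows by induction on <ᴸ-accessibility of l: a
-- <°-predecessor k of l comes with rotⁿ k <ᴸ l, the induction hypothesis
-- makes rotⁿ k <°-accessible, and the invariance above transfers this to k.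

open import Defs
open import Level using (Level)
open import Data.List using (List; []; _∷_; _++_; [_]; length)
open import Data.List.Properties using (++-assoc; ++-identityʳ)
open import Data.Nat using (ℕ; zero; suc; _+_)
open import Data.Product using (_,_)
open import Relation.Binary.PropositionalEquality
  using (_≡_; refl; sym; trans; cong; subst; subst₂; module ≡-Reasoning)

acc-fewer-predecessors : {a r : Level} {B : Set a} {R : B → B → Set r} {m m′ : B} →
  ((j : B) → R j m → R j m′) → acc R m′ → acc R m
acc-fewer-predecessors pred⊆ (step acc′) = step (λ j jRm → acc′ j (pred⊆ j jRm))

module _ {a : Level} {A : Set a} where

  rot^-suc : (n : ℕ) (xs : List A) → rot^ (suc n) xs ≡ rot^ n (rot xs)
  rot^-suc zero    xs = refl
  rot^-suc (suc n) xs = cong rot (rot^-suc n xs)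

  rot^-+ : (q p : ℕ) (xs : List A) → rot^ q (rot^ p xs) ≡ rot^ (q + p) xs
  rot^-+ zero    p xs = refl
  rot^-+ (suc q) p xs = cong rot (rot^-+ q p xs)

  rot^-length : (ys zs : List A) → rot^ (length ys) (ys ++ zs) ≡ zs ++ ys
  rot^-length []       zs = sym (++-identityʳ zs)
  rot^-length (y ∷ ys) zs = begin
      rot^ (suc (length ys)) (y ∷ ys ++ zs)
    ≡⟨ rot^-suc (length ys) (y ∷ ys ++ zs) ⟩
      rot^ (length ys) ((ys ++ zs) ++ [ y ])
    ≡⟨ cong (rot^ (length ys)) (++-assoc ys zs [ y ]) ⟩
      rot^ (length ys) (ys ++ zs ++ [ y ])
    ≡⟨ rot^-length ys (zs ++ [ y ]) ⟩
      (zs ++ [ y ]) ++ ys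
    ≡⟨ ++-assoc zs [ y ] ys ⟩
      zs ++ y ∷ ys
    ∎
    where open ≡-Reasoning

module _ {a r : Level} {A : Set a} (_<_ : A → A → Set r) where

  -- Rotating the larger list of a <ᴸ-step is matched by rotating the smaller:
  -- if l₁ is nonempty, one rotation of k suffices; if the replaced element x
  -- is in front, it moves to the end, and |k| rotations move k there too.
  <ᴸ-rot : (k l : List A) → ListRel _<_ k l → RotRel _<_ k (rot l)
  <ᴸ-rot _ _ (ext [] k l₃ x k<x) =
    length k , subst (λ t → ListRel _<_ t (l₃ ++ [ x ]))
      (trans (cong (l₃ ++_) (++-identityʳ k)) (sym (rot^-length k l₃)))
      (ext l₃ k [] x k<x)
  <ᴸ-rot _ _ (ext (h ∷ l₁) k l₃ x k<x) =
    1 , subst₂ (ListRel _<_)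
      (sym (trans (++-assoc l₁ (k ++ l₃) [ h ]) (cong (l₁ ++_) (++-assoc k l₃ [ h ]))))
      (sym (++-assoc l₁ (x ∷ l₃) [ h ]))
      (ext l₁ k (l₃ ++ [ h ]) x k<x)

  <°-rot : (j m : List A) → RotRel _<_ j m → RotRel _<_ j (rot m)
  <°-rot j m (p , rotᵖj<m) with <ᴸ-rot (rot^ p j) m rotᵖj<m
  ... | q , rotᵠrotᵖj<rotm =
    q + p , subst (λ t → ListRel _<_ t (rot m)) (rot^-+ q p j) rotᵠrotᵖj<rotm

  acc-unrot^ : (n : ℕ) (m : List A) → acc (RotRel _<_) (rot^ n m) → acc (RotRel _<_) m
  acc-unrot^ zero    m accm = accm
  acc-unrot^ (suc n) m accm =
    acc-unrot^ n m (acc-fewer-predecessors (λ j → <°-rot j (rot^ n m)) accm)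

lemma5p9 : {a r : Level} {A : Set a} (_<_ : A → A → Set r) (l : List A) →
    acc (ListRel _<_) l → acc (RotRel _<_) l
lemma5p9 {A = A} _<_ l (step accᴸ) = step predecessor-acc
  where
    predecessor-acc : (k : List A) → RotRel _<_ k l → acc (RotRel _<_) k
    predecessor-acc k (n , rotⁿk<l) =
      acc-unrot^ _<_ n k (lemma5p9 _<_ (rot^ n k) (accᴸ (rot^ n k) rotⁿk<l))
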